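{- For each prime $p$ we have $W_{p,p}(x)\equiv x^{p(p-1)}\pmod p$ (coefficientwise).
   Context: For an integer $d\ge2$ the polynomials $W_{d,m}(x)\in\mathbb{Z}[x]$ are defined by $W_{d,0}(x)=1$ and $W_{d,m+1}(x)=W_{d,m}'(x)+(1+x^{d-1})W_{d,m}(x)$; equivalently, $\frac{d^m}{dx^m}e^{x+x^d/d}=W_{d,m}(x)e^{x+x^d/d}$. -}

module Defs where

open import Data.Nat as ℕ using (ℕ; zero; suc; _∸_; _≤?_)
open import Data.Integer using (ℤ; +_; _+_; _*_; _-_)
open import Relation.Nullary using (yes; no)

-- Integer polynomials represented by their coefficient sequences:
-- a polynomial f is the function k ↦ (coefficient of x^k in f).
Poly : Set
Poly = ℕ → ℤ

one : Poly
one zero    = + 1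
one (suc _) = + 0

monomial : ℕ → Poly
monomial n k with n ℕ.≟ k
... | yes _ = + 1
... | no  _ = + 0

deriv : Poly → Poly
deriv f k = + (suc k) * f (suc k)

shift : ℕ → Poly → Poly
shift n f k with n ≤? k
... | yes _ = f (k ∸ n)
... | no  _ = + 0

W : ℕ → ℕ → Poly
W d zero    = one
W d (suc m) k = deriv (W d m) k + (W d m k + shift (d ∸ 1) (W d m) k)

-- Let L f = f' + x^(p-1) f and V_j = L^j 1. Since W_{p,m+1} = (L + 1) W_{p,m}, the Leibniz rule
-- gives W_{p,p} = Σ_j C(p,j) V_j ≡ 1 + V_p (mod p). Both terms of L lower the degree by 1 modulo p,
-- and modulo p the derivative contributes the factor -j at step j, so the coefficient of x^(pc-j)
-- in V_j is congruent to the Stirling number s(j,c) of x(x-1)⋯(x-j+1); hence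
-- V_p ≡ Σ_c s(p,c) x^(p(c-1)). Finally x(x-1)⋯(x-p+1) ≡ x^p - x (mod p): this polynomial P
-- satisfies P(x+1) - P(x) = p·x(x-1)⋯(x-p+2), and comparing coefficients of P(x+1) ≡ P(x) from
-- the top down kills s(p,c) for 1 < c < p and gives s(p,1) ≡ -1. So V_p ≡ x^(p(p-1)) - 1.
module Submission where

open import Defs
open import Function using (_∘_)
open import Data.Empty using (⊥-elim)
open import Data.Product using (_×_; _,_)
open import Data.Sum using (inj₁; inj₂)
open import Data.Nat as ℕ using (ℕ; zero; suc; _≤_; _<_; z≤n; s≤s; _∸_)
import Data.Nat.Properties as ℕₚ
open import Data.Nat.Combinatorics using (_C_; nCn≡1; nC1≡n; k>n⇒nCk≡0; nCk+nC[k+1]≡[n+1]C[k+1])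
import Data.Nat.Divisibility as ℕ∣
open import Data.Nat.Divisibility using (>⇒∤) renaming (_∣_ to _∣ₙ_; divides to dividesₙ)
open import Data.Nat.Primality using (Prime; euclidsLemma; prime⇒nonZero; prime⇒nonTrivial)
import Data.Nat.Tactic.RingSolver as ℕ-Ring
open import Data.Integer using (ℤ; +_; _+_; _-_; -_; ∣_∣)
import Data.Integer.Properties as ℤₚ
open import Data.Integer.Divisibility.Signed
  using (∣ᵤ⇒∣; ∣⇒∣ᵤ; ∣m∣n⇒∣m+n; ∣m⇒∣-m; ∣n⇒∣m*n; ∣m⇒∣m*n)
  renaming (_∣_ to _∣ₛ_; divides to dividesₛ)
open import Data.Integer.Tactic.RingSolver using (solve-∀)
open import Level using (0ℓ)
open import Relation.Binary.Bundles using (Setoid)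
import Relation.Binary.Reasoning.Setoid
open import Relation.Binary.Definitions using (tri<; tri≈; tri>)
open import Relation.Binary.PropositionalEquality
open import Relation.Nullary using (¬_; yes; no)

-- ℤ's _*_ is opened only inside this module: the statement at the end uses ℕ's _*_.
module _ where
  open import Data.Integer using (_*_)

  -- Finite sums

  Σ< : ℕ → (ℕ → ℤ) → ℤ
  Σ< zero    f = + 0
  Σ< (suc n) f = f 0 + Σ< n (f ∘ suc)

  Σ-cong : ∀ n {f g : ℕ → ℤ} → (∀ i → f i ≡ g i) → Σ< n f ≡ Σ< n g
  Σ-cong zero    f≡g = refl
  Σ-cong (suc n) f≡g = cong₂ _+_ (f≡g 0) (Σ-cong n (f≡g ∘ suc))

  Σ-+ : ∀ n (f g : ℕ → ℤ) → Σ< n (λ i → f i + g i) ≡ Σ< n f + Σ< n g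
  Σ-+ zero    f g = refl
  Σ-+ (suc n) f g = trans (cong (_+_ (f 0 + g 0)) (Σ-+ n (f ∘ suc) (g ∘ suc)))
                          (interchange (f 0) (g 0) (Σ< n (f ∘ suc)) (Σ< n (g ∘ suc)))
    where
    interchange : ∀ a b c d → a + b + (c + d) ≡ a + c + (b + d)
    interchange = solve-∀

  *-distribˡ-Σ : ∀ n a (f : ℕ → ℤ) → a * Σ< n f ≡ Σ< n (λ i → a * f i)
  *-distribˡ-Σ zero    a f = ℤₚ.*-zeroʳ a
  *-distribˡ-Σ (suc n) a f =
    trans (ℤₚ.*-distribˡ-+ a (f 0) _) (cong (_+_ (a * f 0)) (*-distribˡ-Σ n a (f ∘ suc)))

  Σ-last : ∀ n (f : ℕ → ℤ) → Σ< (suc n) f ≡ Σ< n f + f n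
  Σ-last zero    f = trans (ℤₚ.+-identityʳ (f 0)) (sym (ℤₚ.+-identityˡ (f 0)))
  Σ-last (suc n) f = trans (cong (_+_ (f 0)) (Σ-last n (f ∘ suc))) (sym (ℤₚ.+-assoc (f 0) _ _))

  Σ-zero : ∀ n (f : ℕ → ℤ) → (∀ i → i < n → f i ≡ + 0) → Σ< n f ≡ + 0
  Σ-zero zero    f f≡0 = refl
  Σ-zero (suc n) f f≡0 =
    cong₂ _+_ (f≡0 0 (s≤s z≤n)) (Σ-zero n (f ∘ suc) (λ i i<n → f≡0 (suc i) (s≤s i<n)))

  -- Congruences modulo m

  module Modular (m : ℕ) where

    -- A record rather than a synonym, so that a and b can be inferred from a proof of a ≈ b.
    infix 4 _≈_
    record _≈_ (a b : ℤ) : Set where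
      constructor mk≈
      field divides-difference : + m ∣ₛ a - b

    private
      variable
        a b c d : ℤ

    ≈-by : ∀ {x} → + m ∣ₛ x → x ≡ a - b → a ≈ b
    ≈-by m∣x refl = mk≈ m∣x

    ≈-reflexive : a ≡ b → a ≈ b
    ≈-reflexive {a} refl = ≈-by (dividesₛ (+ 0) refl) (sym (ℤₚ.+-inverseʳ a))

    ≈-refl : a ≈ a
    ≈-refl = ≈-reflexive refl

    ≈-sym : a ≈ b → b ≈ a
    ≈-sym {a} {b} (mk≈ m∣a-b) = ≈-by (∣m⇒∣-m m∣a-b) (negate a b)
      where
      negate : ∀ a b → - (a - b) ≡ b - a
      negate = solve-∀

    ≈-trans : a ≈ b → b ≈ c → a ≈ c
    ≈-trans {a} {b} {c} (mk≈ m∣a-b) (mk≈ m∣b-c) =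
      ≈-by (∣m∣n⇒∣m+n m∣a-b m∣b-c) (telescope a b c)
      where
      telescope : ∀ a b c → (a - b) + (b - c) ≡ a - c
      telescope = solve-∀

    ≈-setoid : Setoid 0ℓ 0ℓ
    ≈-setoid = record
      { Carrier       = ℤ
      ; _≈_           = _≈_
      ; isEquivalence = record { refl = ≈-refl ; sym = ≈-sym ; trans = ≈-trans }
      }

    module ≈-Reasoning = Relation.Binary.Reasoning.Setoid ≈-setoid

    +-cong : a ≈ b → c ≈ d → a + c ≈ b + d
    +-cong {a} {b} {c} {d} (mk≈ m∣a-b) (mk≈ m∣c-d) =
      ≈-by (∣m∣n⇒∣m+n m∣a-b m∣c-d) (regroup a b c d)
      where
      regroup : ∀ a b c d → (a - b) + (c - d) ≡ (a + c) - (b + d)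
      regroup = solve-∀

    *-cong : a ≈ b → c ≈ d → a * c ≈ b * d
    *-cong {a} {b} {c} {d} (mk≈ m∣a-b) (mk≈ m∣c-d) =
      ≈-by (∣m∣n⇒∣m+n (∣n⇒∣m*n a m∣c-d) (∣m⇒∣m*n d m∣a-b)) (regroup a b c d)
      where
      regroup : ∀ a b c d → a * (c - d) + (a - b) * d ≡ a * c - b * d
      regroup = solve-∀

    +-cancelˡ-≈ : ∀ a → a + b ≈ a + c → b ≈ c
    +-cancelˡ-≈ {b} {c} a (mk≈ m∣difference) = ≈-by m∣difference (cancel a b c)
      where
      cancel : ∀ a b c → a + b - (a + c) ≡ b - c
      cancel = solve-∀

    ∣⇒≈0 : + m ∣ₛ a → a ≈ + 0
    ∣⇒≈0 {a} m∣a = ≈-by m∣a (sym (ℤₚ.+-identityʳ a))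

    ≈0⇒∣ : a ≈ + 0 → + m ∣ₛ a
    ≈0⇒∣ {a} (mk≈ m∣a-0) = subst (+ m ∣ₛ_) (ℤₚ.+-identityʳ a) m∣a-0

    m*x≈0 : ∀ x → + m * x ≈ + 0
    m*x≈0 x = ∣⇒≈0 (∣m⇒∣m*n x (dividesₛ (+ 1) (sym (ℤₚ.*-identityˡ (+ m)))))

    a≡b+m*x⇒a≈b : ∀ x → a ≡ b + + m * x → a ≈ b
    a≡b+m*x⇒a≈b {a} {b} x refl =
      ≈-trans (+-cong (≈-refl {b}) (m*x≈0 x)) (≈-reflexive (ℤₚ.+-identityʳ b))

    i+j≡m*c⇒i≈-j : ∀ i j c → i ℕ.+ j ≡ m ℕ.* c → + i ≈ - (+ j)
    i+j≡m*c⇒i≈-j i j c i+j≡mc = a≡b+m*x⇒a≈b (+ c) (begin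
        + i                     ≡⟨ cancel (+ i) (+ j) ⟨
        - (+ j) + (+ i + + j)   ≡⟨ cong (_+_ (- (+ j))) (ℤₚ.pos-+ i j) ⟨
        - (+ j) + + (i ℕ.+ j)   ≡⟨ cong (λ z → - (+ j) + + z) i+j≡mc ⟩
        - (+ j) + + (m ℕ.* c)   ≡⟨ cong (_+_ (- (+ j))) (ℤₚ.pos-* m c) ⟩
        - (+ j) + + m * + c     ∎)
      where
      open ≡-Reasoning
      cancel : ∀ a b → - b + (a + b) ≡ a
      cancel = solve-∀

    Σ-≈-prefix : ∀ {k n} {f : ℕ → ℤ} → k ≤ n → (∀ i → k ≤ i → i < n → f i ≈ + 0) →
                 Σ< n f ≈ Σ< k f
    Σ-≈-prefix {k} {n} {f} k≤n f≈0 with ℕₚ.m≤n⇒m<n∨m≡n k≤n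
    ... | inj₂ refl = ≈-refl
    Σ-≈-prefix {k} {suc n} {f} _ f≈0 | inj₁ (s≤s k≤n) = begin
        Σ< (suc n) f     ≡⟨ Σ-last n f ⟩
        Σ< n f + f n     ≈⟨ +-cong (Σ-≈-prefix k≤n (λ i k≤i i<n → f≈0 i k≤i (ℕₚ.m<n⇒m<1+n i<n)))
                                   (f≈0 n k≤n ℕₚ.≤-refl) ⟩
        Σ< k f + + 0     ≡⟨ ℤₚ.+-identityʳ _ ⟩
        Σ< k f           ∎
      where open ≈-Reasoning

  -- Binomial coefficients

  [1+n]Cn≡1+n : ∀ n → suc n C n ≡ suc n
  [1+n]Cn≡1+n zero    = refl
  [1+n]Cn≡1+n (suc n) = begin
    suc (suc n) C suc n           ≡⟨ nCk+nC[k+1]≡[n+1]C[k+1] (suc n) n ⟨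
    suc n C n ℕ.+ suc n C suc n   ≡⟨ cong₂ ℕ._+_ ([1+n]Cn≡1+n n) (nCn≡1 (suc n)) ⟩
    suc n ℕ.+ 1                   ≡⟨ ℕₚ.+-comm (suc n) 1 ⟩
    suc (suc n)                   ∎
    where open ≡-Reasoning

  C-absorption : ∀ n k → suc k ℕ.* (suc n C suc k) ≡ suc n ℕ.* (n C k)
  C-absorption n       zero    =
    trans (ℕₚ.*-identityˡ (suc n C 1)) (trans (nC1≡n (suc n)) (sym (ℕₚ.*-identityʳ (suc n))))
  C-absorption zero    (suc k) = ℕₚ.*-zeroʳ (suc (suc k))
  C-absorption (suc n) (suc k) = begin
      suc (suc k) ℕ.* (suc (suc n) C suc (suc k))
    ≡⟨ cong (suc (suc k) ℕ.*_) (nCk+nC[k+1]≡[n+1]C[k+1] (suc n) (suc k)) ⟨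
      suc (suc k) ℕ.* (A ℕ.+ suc n C suc (suc k))
    ≡⟨ split k A (suc n C suc (suc k)) ⟩
      A ℕ.+ suc k ℕ.* A ℕ.+ suc (suc k) ℕ.* (suc n C suc (suc k))
    ≡⟨ cong₂ (λ x y → A ℕ.+ x ℕ.+ y) (C-absorption n k) (C-absorption n (suc k)) ⟩
      A ℕ.+ suc n ℕ.* (n C k) ℕ.+ suc n ℕ.* (n C suc k)
    ≡⟨ ℕₚ.+-assoc A _ _ ⟩
      A ℕ.+ (suc n ℕ.* (n C k) ℕ.+ suc n ℕ.* (n C suc k))
    ≡⟨ cong (A ℕ.+_) (ℕₚ.*-distribˡ-+ (suc n) (n C k) (n C suc k)) ⟨
      A ℕ.+ suc n ℕ.* (n C k ℕ.+ n C suc k)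
    ≡⟨ cong (λ c → A ℕ.+ suc n ℕ.* c) (nCk+nC[k+1]≡[n+1]C[k+1] n k) ⟩
      suc (suc n) ℕ.* A
    ∎
    where
    open ≡-Reasoning
    A = suc n C suc k
    split : ∀ k a b → (2 ℕ.+ k) ℕ.* (a ℕ.+ b) ≡ a ℕ.+ (1 ℕ.+ k) ℕ.* a ℕ.+ (2 ℕ.+ k) ℕ.* b
    split = ℕ-Ring.solve-∀

  p∣pCk : ∀ {p} k → Prime p → 0 < k → k < p → p ∣ₙ p C k
  p∣pCk {suc q} (suc k) p-prime _ k<p
    with euclidsLemma (suc k) (suc q C suc k) p-prime
           (dividesₙ (q C k) (trans (C-absorption q k) (ℕₚ.*-comm (suc q) (q C k))))
  ... | inj₁ p∣1+k = ⊥-elim (>⇒∤ k<p p∣1+k)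
  ... | inj₂ p∣C   = p∣C

  module _ {p : ℕ} (p-prime : Prime p) where
    open Modular p

    pCk≈0 : ∀ k → 0 < k → k < p → + (p C k) ≈ + 0
    pCk≈0 k 0<k k<p = ∣⇒≈0 (∣ᵤ⇒∣ (p∣pCk k p-prime 0<k k<p))

    *-cancelˡ-≈0 : ∀ a {u} → suc a < p → + suc a * u ≈ + 0 → u ≈ + 0
    *-cancelˡ-≈0 a {u} a<p au≈0
      with euclidsLemma (suc a) ∣ u ∣ p-prime
             (subst (p ∣ₙ_) (ℤₚ.abs-* (+ suc a) u) (∣⇒∣ᵤ (≈0⇒∣ au≈0)))
    ... | inj₁ p∣a = ⊥-elim (>⇒∤ a<p p∣a)
    ... | inj₂ p∣u = ∣⇒≈0 (∣ᵤ⇒∣ p∣u)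

  -- The polynomials V d j

  shift-vanishes : ∀ n k (f : Poly) → (n ≤ k → f (k ∸ n) ≡ + 0) → shift n f k ≡ + 0
  shift-vanishes n k f f≡0 with n ℕ.≤? k
  ... | yes n≤k = f≡0 n≤k
  ... | no _    = refl

  shift-cong : ∀ n k {f g : Poly} → (∀ i → f i ≡ g i) → shift n f k ≡ shift n g k
  shift-cong n k f≡g with n ℕ.≤? k
  ... | yes _ = f≡g (k ∸ n)
  ... | no _  = refl

  shift-Σ : ∀ n k N (a : ℕ → ℤ) (F : ℕ → Poly) →
            shift n (λ i → Σ< N (λ j → a j * F j i)) k ≡ Σ< N (λ j → a j * shift n (F j) k)
  shift-Σ n k N a F with n ℕ.≤? k
  ... | yes _ = refl
  ... | no _  = sym (Σ-zero N _ (λ j _ → ℤₚ.*-zeroʳ (a j)))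

  -- (d/dx) (f e^(x^d/d)) = (L d f) e^(x^d/d), hence (d/dx)^j e^(x^d/d) = V d j · e^(x^d/d).
  L : ℕ → Poly → Poly
  L d f k = deriv f k + shift (d ∸ 1) f k

  V : ℕ → ℕ → Poly
  V d zero    = one
  V d (suc j) = L d (V d j)

  L-cong : ∀ d k {f g : Poly} → (∀ i → f i ≡ g i) → L d f k ≡ L d g k
  L-cong d k f≡g = cong₂ _+_ (cong (+ suc k *_) (f≡g (suc k))) (shift-cong (d ∸ 1) k f≡g)

  L-Σ : ∀ d k N (a : ℕ → ℤ) (F : ℕ → Poly) →
        L d (λ i → Σ< N (λ j → a j * F j i)) k ≡ Σ< N (λ j → a j * L d (F j) k)
  L-Σ d k N a F = begin
      + suc k * Σ< N (λ j → a j * F j (suc k)) + shift (d ∸ 1) (λ i → Σ< N (λ j → a j * F j i)) k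
    ≡⟨ cong₂ _+_ (*-distribˡ-Σ N (+ suc k) _) (shift-Σ (d ∸ 1) k N a F) ⟩
      Σ< N (λ j → + suc k * (a j * F j (suc k))) + Σ< N (λ j → a j * shift (d ∸ 1) (F j) k)
    ≡⟨ Σ-+ N (λ j → + suc k * (a j * F j (suc k))) (λ j → a j * shift (d ∸ 1) (F j) k) ⟨
      Σ< N (λ j → + suc k * (a j * F j (suc k)) + a j * shift (d ∸ 1) (F j) k)
    ≡⟨ Σ-cong N (λ j → factor (+ suc k) (a j) (F j (suc k)) (shift (d ∸ 1) (F j) k)) ⟩
      Σ< N (λ j → a j * L d (F j) k)
    ∎
    where
    open ≡-Reasoning
    factor : ∀ s a v w → s * (a * v) + a * w ≡ a * (s * v + w)
    factor = solve-∀

  Σ-pascal : ∀ m (F : ℕ → ℤ) →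
    Σ< (suc (suc m)) (λ j → + (suc m C j) * F j) ≡
    Σ< (suc m) (λ j → + (m C j) * F (suc j)) + Σ< (suc m) (λ j → + (m C j) * F j)
  Σ-pascal m F = begin
      + 1 * F 0 + Σ< (suc m) (λ j → + (suc m C suc j) * F (suc j))
    ≡⟨ cong (_+_ (+ 1 * F 0)) (Σ-cong (suc m) pascal) ⟩
      + 1 * F 0 + Σ< (suc m) (λ j → + (m C j) * F (suc j) + + (m C suc j) * F (suc j))
    ≡⟨ cong (_+_ (+ 1 * F 0)) (Σ-+ (suc m) (λ j → + (m C j) * F (suc j)) G) ⟩
      + 1 * F 0 + (A + Σ< (suc m) G)
    ≡⟨ cong (λ s → + 1 * F 0 + (A + s)) (Σ-last m G) ⟩
      + 1 * F 0 + (A + (Σ< m G + + (m C suc m) * F (suc m)))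
    ≡⟨ cong (λ c → + 1 * F 0 + (A + (Σ< m G + + c * F (suc m)))) (k>n⇒nCk≡0 (ℕₚ.n<1+n m)) ⟩
      + 1 * F 0 + (A + (Σ< m G + + 0 * F (suc m)))
    ≡⟨ rearrange (F 0) A (Σ< m G) (F (suc m)) ⟩
      A + (+ 1 * F 0 + Σ< m G)
    ∎
    where
    open ≡-Reasoning
    A = Σ< (suc m) (λ j → + (m C j) * F (suc j))
    G : ℕ → ℤ
    G j = + (m C suc j) * F (suc j)
    pascal : ∀ j → + (suc m C suc j) * F (suc j) ≡ + (m C j) * F (suc j) + G j
    pascal j = begin
      + (suc m C suc j) * F (suc j)             ≡⟨ cong (λ c → + c * F (suc j))
                                                        (nCk+nC[k+1]≡[n+1]C[k+1] m j) ⟨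
      + (m C j ℕ.+ m C suc j) * F (suc j)       ≡⟨ cong (_* F (suc j)) (ℤₚ.pos-+ (m C j) (m C suc j)) ⟩
      (+ (m C j) + + (m C suc j)) * F (suc j)   ≡⟨ ℤₚ.*-distribʳ-+ (F (suc j)) (+ (m C j)) (+ (m C suc j)) ⟩
      + (m C j) * F (suc j) + G j               ∎
    rearrange : ∀ f a b x → + 1 * f + (a + (b + + 0 * x)) ≡ a + (+ 1 * f + b)
    rearrange = solve-∀

  W≡ΣCV : ∀ d m k → W d m k ≡ Σ< (suc m) (λ j → + (m C j) * V d j k)
  W≡ΣCV d zero    k = sym (trans (ℤₚ.+-identityʳ _) (ℤₚ.*-identityˡ (one k)))
  W≡ΣCV d (suc m) k = begin
      deriv (W d m) k + (W d m k + shift (d ∸ 1) (W d m) k)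
    ≡⟨ regroup (deriv (W d m) k) (W d m k) (shift (d ∸ 1) (W d m) k) ⟩
      L d (W d m) k + W d m k
    ≡⟨ cong₂ _+_ (L-cong d k (W≡ΣCV d m)) (W≡ΣCV d m k) ⟩
      L d (λ i → Σ< (suc m) (λ j → + (m C j) * V d j i)) k + S
    ≡⟨ cong (_+ S) (L-Σ d k (suc m) (λ j → + (m C j)) (V d)) ⟩
      Σ< (suc m) (λ j → + (m C j) * V d (suc j) k) + S
    ≡⟨ Σ-pascal m (λ j → V d j k) ⟨
      Σ< (suc (suc m)) (λ j → + (suc m C j) * V d j k)
    ∎
    where
    open ≡-Reasoning
    S = Σ< (suc m) (λ j → + (m C j) * V d j k)
    regroup : ∀ a b c → a + (b + c) ≡ (a + c) + b
    regroup = solve-∀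

  -- x(x-1)⋯(x-n+1) = Σ_k stirling n k · x^k
  stirling : ℕ → ℕ → ℤ
  stirling zero    zero    = + 1
  stirling zero    (suc k) = + 0
  stirling (suc n) zero    = + 0
  stirling (suc n) (suc k) = stirling n k - + n * stirling n (suc k)

  stirling-suc : ∀ n k → stirling (suc n) k ≡ shift 1 (stirling n) k - + n * stirling n k
  stirling-suc zero    zero    = refl
  stirling-suc (suc n) zero    = sym (cong (λ x → + 0 - x) (ℤₚ.*-zeroʳ (+ suc n)))
  stirling-suc n       (suc k) = refl

  stirling-above : ∀ {n k} → n < k → stirling n k ≡ + 0
  stirling-above {zero}  {suc k} _         = refl
  stirling-above {suc n} {suc k} (s≤s n<k) = begin
    stirling n k - + n * stirling n (suc k)  ≡⟨ cong₂ (λ a b → a - + n * b) (stirling-above n<k)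
                                                      (stirling-above (ℕₚ.m<n⇒m<1+n n<k)) ⟩
    + 0 - + n * + 0                          ≡⟨ cong (λ x → + 0 - x) (ℤₚ.*-zeroʳ (+ n)) ⟩
    + 0                                      ∎
    where open ≡-Reasoning

  stirling-diag : ∀ n → stirling n n ≡ + 1
  stirling-diag zero    = refl
  stirling-diag (suc n) = begin
    stirling n n - + n * stirling n (suc n)  ≡⟨ cong₂ (λ a b → a - + n * b) (stirling-diag n)
                                                      (stirling-above (ℕₚ.n<1+n n)) ⟩
    + 1 - + n * + 0                          ≡⟨ cong (λ x → + 1 - x) (ℤₚ.*-zeroʳ (+ n)) ⟩
    + 1                                      ∎
    where open ≡-Reasoning

  -- V d j modulo d

  n∸d+j+[1+d]≡n+[1+j] : ∀ {d n} j → d ≤ n → n ∸ d ℕ.+ j ℕ.+ suc d ≡ n ℕ.+ suc j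
  n∸d+j+[1+d]≡n+[1+j] {d} {n} j d≤n = begin
    n ∸ d ℕ.+ j ℕ.+ suc d     ≡⟨ swap (n ∸ d) j d ⟩
    n ∸ d ℕ.+ d ℕ.+ suc j     ≡⟨ cong (ℕ._+ suc j) (ℕₚ.m∸n+n≡m d≤n) ⟩
    n ℕ.+ suc j               ∎
    where
    open ≡-Reasoning
    swap : ∀ x j d → x ℕ.+ j ℕ.+ suc d ≡ x ℕ.+ d ℕ.+ suc j
    swap = ℕ-Ring.solve-∀

  shifted-degree : ∀ {d n j c} → d ≤ n → n ℕ.+ suc j ≡ suc d ℕ.* suc c →
                   n ∸ d ℕ.+ j ≡ suc d ℕ.* c
  shifted-degree {d} {n} {j} {c} d≤n eq = ℕₚ.+-cancelʳ-≡ (suc d) _ _ (begin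
    n ∸ d ℕ.+ j ℕ.+ suc d     ≡⟨ n∸d+j+[1+d]≡n+[1+j] j d≤n ⟩
    n ℕ.+ suc j               ≡⟨ eq ⟩
    suc d ℕ.* suc c           ≡⟨ ℕₚ.*-suc (suc d) c ⟩
    suc d ℕ.+ suc d ℕ.* c     ≡⟨ ℕₚ.+-comm (suc d) _ ⟩
    suc d ℕ.* c ℕ.+ suc d     ∎)
    where open ≡-Reasoning

  low-degree : ∀ {d n j c} → n < d → j ≤ d → n ℕ.+ suc j ≡ suc d ℕ.* suc c → c ≡ 0 × 0 < j
  low-degree {d} {n} {zero}  {zero}  n<d _ eq = ⊥-elim (ℕₚ.<-irrefl n≡d n<d)
    where
    n≡d : n ≡ d
    n≡d = ℕₚ.suc-injective (trans (ℕₚ.+-comm 1 n) (trans eq (ℕₚ.*-identityʳ (suc d))))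
  low-degree {j = suc j} {zero}  _ _ _ = refl , s≤s z≤n
  low-degree {d} {n} {j} {suc c} n<d j≤d eq = ⊥-elim (ℕₚ.<-irrefl refl (begin-strict
    suc d ℕ.+ suc d             ≤⟨ ℕₚ.+-monoʳ-≤ (suc d) (ℕₚ.m≤m*n (suc d) (suc c)) ⟩
    suc d ℕ.+ suc d ℕ.* suc c   ≡⟨ ℕₚ.*-suc (suc d) (suc c) ⟨
    suc d ℕ.* suc (suc c)       ≡⟨ eq ⟨
    n ℕ.+ suc j                 <⟨ ℕₚ.+-mono-<-≤ n<d (s≤s j≤d) ⟩
    d ℕ.+ suc d                 <⟨ ℕₚ.n<1+n (d ℕ.+ suc d) ⟩
    suc d ℕ.+ suc d             ∎))
    where open ℕₚ.≤-Reasoning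

  module _ (d : ℕ) where
    open Modular (suc d)

    V-support : ∀ j n → ¬ suc d ∣ₙ n ℕ.+ j → V (suc d) j n ≡ + 0
    V-support zero    zero    d∤0 = ⊥-elim (d∤0 (dividesₙ 0 refl))
    V-support zero    (suc n) _   = refl
    V-support (suc j) n       d∤  = begin
        + suc n * V (suc d) j (suc n) + shift d (V (suc d) j) n
      ≡⟨ cong₂ _+_ (cong (+ suc n *_)
                         (V-support j (suc n) (d∤ ∘ subst (suc d ∣ₙ_) (sym (ℕₚ.+-suc n j)))))
                   (shift-vanishes d n (V (suc d) j) shifted) ⟩
        + suc n * + 0 + + 0
      ≡⟨ cong (_+ + 0) (ℤₚ.*-zeroʳ (+ suc n)) ⟩
        + 0
      ∎
      where
      open ≡-Reasoning
      shifted : d ≤ n → V (suc d) j (n ∸ d) ≡ + 0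
      shifted d≤n = V-support j (n ∸ d)
        (λ d∣ → d∤ (subst (suc d ∣ₙ_) (n∸d+j+[1+d]≡n+[1+j] j d≤n)
                          (ℕ∣.∣m∣n⇒∣m+n d∣ ℕ∣.∣-refl)))

    -- At degree n = (d+1)c - (j+1) the derivative term carries the factor n + 1 ≡ -j, giving
    -- the Stirling recurrence. The bound j ≤ d + 1 matters when n < d: the x^d-term is then
    -- absent, and the bound forces c = 1, so that its counterpart stirling j 0 vanishes too.
    V≈stirling : ∀ j c n → j ≤ suc d → n ℕ.+ j ≡ suc d ℕ.* c → V (suc d) j n ≈ stirling j c
    V≈stirling zero    zero    zero    _ _  = ≈-refl
    V≈stirling zero    zero    (suc n) _ eq = ⊥-elim (ℕₚ.1+n≢0 (trans eq (ℕₚ.*-zeroʳ (suc d))))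
    V≈stirling zero    (suc c) (suc n) _ _  = ≈-refl
    V≈stirling (suc j) zero    n       _ eq =
      ⊥-elim (ℕₚ.1+n≢0 (trans (sym (ℕₚ.+-suc n j)) (trans eq (ℕₚ.*-zeroʳ (suc d)))))
    V≈stirling (suc j) (suc c) n (s≤s j≤d) eq = begin
        + suc n * V (suc d) j (suc n) + shift d (V (suc d) j) n
      ≈⟨ +-cong (*-cong (i+j≡m*c⇒i≈-j (suc n) j (suc c) eq′)
                        (V≈stirling j (suc c) (suc n) (ℕₚ.m≤n⇒m≤1+n j≤d) eq′))
                shifted ⟩
        - (+ j) * stirling j (suc c) + stirling j c
      ≡⟨ ℤₚ.+-comm (- (+ j) * stirling j (suc c)) (stirling j c) ⟩
        stirling j c + - (+ j) * stirling j (suc c)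
      ≡⟨ cong (_+_ (stirling j c)) (ℤₚ.neg-distribˡ-* (+ j) (stirling j (suc c))) ⟨
        stirling (suc j) (suc c)
      ∎
      where
      open ≈-Reasoning
      eq′ : suc n ℕ.+ j ≡ suc d ℕ.* suc c
      eq′ = trans (sym (ℕₚ.+-suc n j)) eq
      stirling-below : ∀ {j} → 0 < j → stirling j 0 ≡ + 0
      stirling-below {suc j} _ = refl
      shifted : shift d (V (suc d) j) n ≈ stirling j c
      shifted with d ℕ.≤? n
      ... | yes d≤n = V≈stirling j c (n ∸ d) (ℕₚ.m≤n⇒m≤1+n j≤d) (shifted-degree d≤n eq)
      ... | no d≰n  with low-degree (ℕₚ.≰⇒> d≰n) j≤d eq
      ...   | refl , 0<j = ≈-reflexive (sym (stirling-below 0<j))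

  -- coefficients of (x+1)x(x-1)⋯(x-n+2)
  shiftedStirling : ℕ → ℕ → ℤ
  shiftedStirling n k = Σ< (suc n) (λ j → + (j C k) * stirling n j)

  Σ-C-suc : ∀ N k (g : ℕ → ℤ) →
    Σ< N (λ j → + (suc j C k) * g j) ≡
    Σ< N (λ j → + (j C k) * g j) + shift 1 (λ i → Σ< N (λ j → + (j C i) * g j)) k
  Σ-C-suc N zero    g = sym (ℤₚ.+-identityʳ _)
  Σ-C-suc N (suc k) g = begin
      Σ< N (λ j → + (suc j C suc k) * g j)
    ≡⟨ Σ-cong N pascal ⟩
      Σ< N (λ j → + (j C suc k) * g j + + (j C k) * g j)
    ≡⟨ Σ-+ N (λ j → + (j C suc k) * g j) (λ j → + (j C k) * g j) ⟩
      Σ< N (λ j → + (j C suc k) * g j) + Σ< N (λ j → + (j C k) * g j)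
    ∎
    where
    open ≡-Reasoning
    pascal : ∀ j → + (suc j C suc k) * g j ≡ + (j C suc k) * g j + + (j C k) * g j
    pascal j = begin
      + (suc j C suc k) * g j                ≡⟨ cong (λ c → + c * g j) (nCk+nC[k+1]≡[n+1]C[k+1] j k) ⟨
      + (j C k ℕ.+ j C suc k) * g j          ≡⟨ cong (λ c → + c * g j) (ℕₚ.+-comm (j C k) (j C suc k)) ⟩
      + (j C suc k ℕ.+ j C k) * g j          ≡⟨ cong (_* g j) (ℤₚ.pos-+ (j C suc k) (j C k)) ⟩
      (+ (j C suc k) + + (j C k)) * g j      ≡⟨ ℤₚ.*-distribʳ-+ (g j) (+ (j C suc k)) (+ (j C k)) ⟩
      + (j C suc k) * g j + + (j C k) * g j  ∎

  shiftedStirling-rec : ∀ n k → shiftedStirling (suc n) k ≡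
    shiftedStirling n k + shift 1 (shiftedStirling n) k - + n * shiftedStirling n k
  shiftedStirling-rec n k = begin
      Σ< (suc (suc n)) (λ j → + (j C k) * stirling (suc n) j)
    ≡⟨ Σ-cong (suc (suc n)) (λ j → trans (cong (+ (j C k) *_) (stirling-suc n j))
                                          (expand (+ (j C k)) (shift 1 (stirling n) j) (+ n) (stirling n j))) ⟩
      Σ< (suc (suc n)) (λ j → + (j C k) * shift 1 (stirling n) j + - + n * F j)
    ≡⟨ Σ-+ (suc (suc n)) (λ j → + (j C k) * shift 1 (stirling n) j) (λ j → - + n * F j) ⟩
      + (0 C k) * + 0 + Σ< (suc n) (λ j → + (suc j C k) * stirling n j)
        + Σ< (suc (suc n)) (λ j → - + n * F j)
    ≡⟨ cong₂ (λ a b → + (0 C k) * + 0 + a + b) (Σ-C-suc (suc n) k (stirling n))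
             (sym (*-distribˡ-Σ (suc (suc n)) (- + n) F)) ⟩
      + (0 C k) * + 0 + (S + S′) + - + n * Σ< (suc (suc n)) F
    ≡⟨ cong (λ s → + (0 C k) * + 0 + (S + S′) + - + n * s) (Σ-last (suc n) F) ⟩
      + (0 C k) * + 0 + (S + S′) + - + n * (S + F (suc n))
    ≡⟨ cong (λ s → + (0 C k) * + 0 + (S + S′) + - + n * (S + s)) top-vanishes ⟩
      + (0 C k) * + 0 + (S + S′) + - + n * (S + + 0)
    ≡⟨ rearrange (+ (0 C k)) S S′ (+ n) ⟩
      S + S′ - + n * S
    ∎
    where
    open ≡-Reasoning
    F : ℕ → ℤ
    F j = + (j C k) * stirling n j
    S  = shiftedStirling n k
    S′ = shift 1 (shiftedStirling n) k
    top-vanishes : F (suc n) ≡ + 0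
    top-vanishes = trans (cong (+ (suc n C k) *_) (stirling-above (ℕₚ.n<1+n n)))
                         (ℤₚ.*-zeroʳ (+ (suc n C k)))
    expand : ∀ c a m b → c * (a - m * b) ≡ c * a + - m * (c * b)
    expand = solve-∀
    rearrange : ∀ c r s m → c * + 0 + (r + s) + - m * (r + + 0) ≡ r + s - m * r
    rearrange = solve-∀

  -- P_(n+1)(x+1) = (x+1) P_n(x), where P_n = x(x-1)⋯(x-n+1)
  shiftedStirling-closed : ∀ n k → shiftedStirling (suc n) k ≡ stirling n k + shift 1 (stirling n) k
  shiftedStirling-closed zero    zero          = refl
  shiftedStirling-closed zero    (suc zero)    = refl
  shiftedStirling-closed zero    (suc (suc k)) = refl
  shiftedStirling-closed (suc n) zero          = begin
      shiftedStirling (suc (suc n)) 0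
    ≡⟨ shiftedStirling-rec (suc n) 0 ⟩
      shiftedStirling (suc n) 0 + + 0 - + suc n * shiftedStirling (suc n) 0
    ≡⟨ cong (λ a → a + + 0 - + suc n * a) (shiftedStirling-closed n 0) ⟩
      stirling n 0 + + 0 + + 0 - + suc n * (stirling n 0 + + 0)
    ≡⟨ rearrange (stirling n 0) (+ n) ⟩
      (+ 0 - + n * stirling n 0) + + 0
    ≡⟨ cong (_+ + 0) (stirling-suc n 0) ⟨
      stirling (suc n) 0 + + 0
    ∎
    where
    open ≡-Reasoning
    rearrange : ∀ a m → a + + 0 + + 0 - (+ 1 + m) * (a + + 0) ≡ (+ 0 - m * a) + + 0
    rearrange = solve-∀
  shiftedStirling-closed (suc n) (suc k)       = begin
      shiftedStirling (suc (suc n)) (suc k)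
    ≡⟨ shiftedStirling-rec (suc n) (suc k) ⟩
      shiftedStirling (suc n) (suc k) + shiftedStirling (suc n) k - + suc n * shiftedStirling (suc n) (suc k)
    ≡⟨ cong₂ (λ a b → a + b - + suc n * a)
             (shiftedStirling-closed n (suc k)) (shiftedStirling-closed n k) ⟩
      stirling n (suc k) + stirling n k + (stirling n k + shift 1 (stirling n) k)
        - + suc n * (stirling n (suc k) + stirling n k)
    ≡⟨ rearrange (stirling n (suc k)) (stirling n k) (shift 1 (stirling n) k) (+ n) ⟩
      stirling (suc n) (suc k) + (shift 1 (stirling n) k - + n * stirling n k)
    ≡⟨ cong (_+_ (stirling (suc n) (suc k))) (stirling-suc n k) ⟨
      stirling (suc n) (suc k) + stirling (suc n) k
    ∎
    where
    open ≡-Reasoning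
    rearrange : ∀ a b c m → a + b + (b + c) - (+ 1 + m) * (a + b) ≡ (b - m * a) + (c - m * b)
    rearrange = solve-∀

  monomial-diag : ∀ n → monomial n n ≡ + 1
  monomial-diag n with n ℕ.≟ n
  ... | yes _   = refl
  ... | no n≢n  = ⊥-elim (n≢n refl)

  monomial-≢ : ∀ {n k} → n ≢ k → monomial n k ≡ + 0
  monomial-≢ {n} {k} n≢k with n ℕ.≟ k
  ... | yes n≡k = ⊥-elim (n≢k n≡k)
  ... | no _    = refl

  monomial-cong : ∀ {n k n′ k′} → (n ≡ k → n′ ≡ k′) → (n′ ≡ k′ → n ≡ k) →
                  monomial n k ≡ monomial n′ k′
  monomial-cong {n} {k} {n′} {k′} to from with n ℕ.≟ k
  ... | yes n≡k = sym (trans (cong₂ monomial (to n≡k) refl) (monomial-diag k′))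
  ... | no n≢k  = sym (monomial-≢ (n≢k ∘ from))

  one≡monomial-0 : ∀ k → one k ≡ monomial 0 k
  one≡monomial-0 zero    = refl
  one≡monomial-0 (suc k) = refl

  -- The prime case

  module _ {q : ℕ} (p-prime : Prime (suc q)) where
    private
      p = suc q
      a = stirling p
    open Modular p

    1≤q : 1 ≤ q
    1≤q = ℕ.s≤s⁻¹ (ℕ.nonTrivial⇒n>1 p {{prime⇒nonTrivial p-prime}})

    -- P(x+1) - P(x) = p · x(x-1)⋯(x-p+2) for P = x(x-1)⋯(x-p+1)
    shiftedStirling≈stirling : ∀ k → shiftedStirling p k ≈ a k
    shiftedStirling≈stirling k = a≡b+m*x⇒a≈b (stirling q k) (begin
      shiftedStirling p k                        ≡⟨ shiftedStirling-closed q k ⟩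
      stirling q k + shift 1 (stirling q) k      ≡⟨ rearrange (stirling q k) (shift 1 (stirling q) k) (+ q) ⟩
      shift 1 (stirling q) k - + q * stirling q k + + p * stirling q k
                                                 ≡⟨ cong (_+ + p * stirling q k) (stirling-suc q k) ⟨
      a k + + p * stirling q k                   ∎)
      where
      open ≡-Reasoning
      rearrange : ∀ s t m → s + t ≡ t - m * s + (+ 1 + m) * s
      rearrange = solve-∀

    Vanishes-above : ℕ → Set
    Vanishes-above k = ∀ i → k < i → i < p → a i ≈ + 0

    -- The coefficient of x^k in P(x+1) ≡ P(x), once the coefficients strictly between k + 1 and p
    -- are known to vanish.
    coefficient-relation : ∀ k → k < q → Vanishes-above (suc k) → + suc k * a (suc k) + + (p C k) ≈ + 0
    coefficient-relation k k<q vanishes = +-cancelˡ-≈ (a k) (begin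
        a k + (+ suc k * a (suc k) + + (p C k))
      ≡⟨ rearrange (a k) (+ suc k * a (suc k)) (+ (p C k)) ⟩
        + 0 + a k + + suc k * a (suc k) + + (p C k)
      ≡⟨ cong₂ _+_ (cong₂ _+_ (cong₂ _+_ low diag) next) top ⟨
        Σ< k F + F k + F (suc k) + F p
      ≡⟨ cong (_+ F p) (trans (Σ-last (suc k) F) (cong (_+ F (suc k)) (Σ-last k F))) ⟨
        Σ< (suc (suc k)) F + F p
      ≈⟨ +-cong (Σ-≈-prefix {f = F} (s≤s k<q) middle) ≈-refl ⟨
        Σ< p F + F p
      ≡⟨ Σ-last p F ⟨
        shiftedStirling p k
      ≈⟨ shiftedStirling≈stirling k ⟩
        a k
      ≡⟨ ℤₚ.+-identityʳ (a k) ⟨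
        a k + + 0
      ∎)
      where
      open ≈-Reasoning
      F : ℕ → ℤ
      F j = + (j C k) * a j
      low : Σ< k F ≡ + 0
      low = Σ-zero k F (λ i i<k → trans (cong (λ c → + c * a i) (k>n⇒nCk≡0 i<k)) (ℤₚ.*-zeroˡ (a i)))
      diag : F k ≡ a k
      diag = trans (cong (λ c → + c * a k) (nCn≡1 k)) (ℤₚ.*-identityˡ (a k))
      next : F (suc k) ≡ + suc k * a (suc k)
      next = cong (λ c → + c * a (suc k)) ([1+n]Cn≡1+n k)
      middle : ∀ i → suc (suc k) ≤ i → i < p → F i ≈ + 0
      middle i 2+k≤i i<p = ≈-trans (*-cong (≈-refl {+ (i C k)}) (vanishes i 2+k≤i i<p))
                                   (≈-reflexive (ℤₚ.*-zeroʳ (+ (i C k))))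
      top : F p ≡ + (p C k)
      top = trans (cong (+ (p C k) *_) (stirling-diag p)) (ℤₚ.*-identityʳ (+ (p C k)))
      rearrange : ∀ s t u → s + (t + u) ≡ + 0 + s + t + u
      rearrange = solve-∀

    vanishes-above-suc : ∀ {k} → a (suc k) ≈ + 0 → Vanishes-above (suc k) → Vanishes-above k
    vanishes-above-suc {k} a[1+k]≈0 above i k<i i<p with ℕₚ.m≤n⇒m<n∨m≡n k<i
    ... | inj₁ 1+k<i = above i 1+k<i i<p
    ... | inj₂ refl  = a[1+k]≈0

    -- Descending induction: e = q - k.
    vanishes-above : ∀ e k → 0 < k → k ℕ.+ e ≡ q → Vanishes-above k
    vanishes-above zero    k _   refl i k<i (s≤s i≤k) =
      ⊥-elim (ℕₚ.<⇒≱ k<i (subst (i ≤_) (ℕₚ.+-identityʳ k) i≤k))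
    vanishes-above (suc e) k 0<k k+1+e≡q = vanishes-above-suc a[1+k]≈0 above
      where
      k<q : k < q
      k<q = subst (k <_) k+1+e≡q (ℕₚ.m<m+n k (s≤s z≤n))
      above : Vanishes-above (suc k)
      above = vanishes-above e (suc k) (s≤s z≤n) (trans (sym (ℕₚ.+-suc k e)) k+1+e≡q)
      a[1+k]≈0 : a (suc k) ≈ + 0
      a[1+k]≈0 = *-cancelˡ-≈0 p-prime k (s≤s k<q) (begin
          + suc k * a (suc k)
        ≡⟨ ℤₚ.+-identityʳ _ ⟨
          + suc k * a (suc k) + + 0
        ≈⟨ +-cong (≈-refl {+ suc k * a (suc k)})
                  (pCk≈0 p-prime k 0<k (ℕₚ.<-trans k<q (ℕₚ.n<1+n q))) ⟨
          + suc k * a (suc k) + + (p C k)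
        ≈⟨ coefficient-relation k k<q above ⟩
          + 0
        ∎)
        where open ≈-Reasoning

    stirling-middle : Vanishes-above 1
    stirling-middle = vanishes-above (q ∸ 1) 1 (s≤s z≤n) (ℕₚ.m+[n∸m]≡n 1≤q)

    stirling-one : a 1 ≈ - + 1
    stirling-one = begin
      a 1                          ≡⟨ rearrange (a 1) ⟩
      + 1 * a 1 + + (p C 0) - + 1  ≈⟨ +-cong (coefficient-relation 0 1≤q stirling-middle) ≈-refl ⟩
      + 0 - + 1                    ∎
      where
      open ≈-Reasoning
      rearrange : ∀ x → x ≡ + 1 * x + + 1 - + 1
      rearrange = solve-∀

    stirling-prime : ∀ k → a k ≈ monomial p k - monomial 1 k
    stirling-prime zero          = ≈-refl
    stirling-prime (suc zero)    =
      ≈-trans stirling-one (≈-reflexive (cong (_- + 1) (sym (monomial-≢ p≢1))))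
      where
      p≢1 : p ≢ 1
      p≢1 refl with 1≤q
      ... | ()
    stirling-prime k@(suc (suc _)) with ℕₚ.<-cmp k p
    ... | tri< k<p k≢p _ = ≈-trans (stirling-middle k (s≤s (s≤s z≤n)) k<p)
                                   (≈-reflexive (cong (_- + 0) (sym (monomial-≢ (k≢p ∘ sym)))))
    ... | tri≈ _ refl _  = ≈-reflexive (trans (stirling-diag p) (cong (_- + 0) (sym (monomial-diag p))))
    ... | tri> _ k≢p p<k =
      ≈-reflexive (trans (stirling-above p<k) (cong (_- + 0) (sym (monomial-≢ (k≢p ∘ sym)))))

    V≈monomial : ∀ k → V p p k ≈ monomial (p ℕ.* q) k - one k
    V≈monomial k with p ℕ∣.∣? k
    ... | yes (dividesₙ c refl) = begin
        V p p (c ℕ.* p)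
      ≈⟨ V≈stirling q p (suc c) (c ℕ.* p) ℕₚ.≤-refl
                    (trans (ℕₚ.+-comm (c ℕ.* p) p) (ℕₚ.*-comm (suc c) p)) ⟩
        a (suc c)
      ≈⟨ stirling-prime (suc c) ⟩
        monomial p (suc c) - monomial 1 (suc c)
      ≡⟨ cong₂ _-_ (monomial-cong top-to top-from)
                   (trans (monomial-cong bottom-to bottom-from) (sym (one≡monomial-0 (c ℕ.* p)))) ⟩
        monomial (p ℕ.* q) (c ℕ.* p) - one (c ℕ.* p)
      ∎
      where
      open ≈-Reasoning
      top-to : ∀ {c} → p ≡ suc c → p ℕ.* q ≡ c ℕ.* p
      top-to refl = ℕₚ.*-comm p q
      top-from : ∀ {c} → p ℕ.* q ≡ c ℕ.* p → p ≡ suc c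
      top-from {c} pq≡cp = cong suc (ℕₚ.*-cancelʳ-≡ q c p (trans (ℕₚ.*-comm q p) pq≡cp))
      bottom-to : ∀ {c} → 1 ≡ suc c → 0 ≡ c ℕ.* p
      bottom-to refl = refl
      bottom-from : ∀ {c} → 0 ≡ c ℕ.* p → 1 ≡ suc c
      bottom-from {c = zero} _ = refl
      bottom-from {c = suc _} ()
    ... | no p∤k = ≈-reflexive (begin
        V p p k                            ≡⟨ V-support q p k (p∤k ∘ cancel-p) ⟩
        + 0                                ≡⟨ cong₂ _-_ (monomial-≢ (p∤k ∘ divides-k)) (one-vanishes p∤k) ⟨
        monomial (p ℕ.* q) k - one k       ∎)
      where
      open ≡-Reasoning
      cancel-p : p ∣ₙ k ℕ.+ p → p ∣ₙ k
      cancel-p p∣k+p = ℕ∣.∣m+n∣m⇒∣n (subst (p ∣ₙ_) (ℕₚ.+-comm k p) p∣k+p) ℕ∣.∣-refl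
      divides-k : ∀ {k} → p ℕ.* q ≡ k → p ∣ₙ k
      divides-k refl = dividesₙ q (ℕₚ.*-comm p q)
      one-vanishes : ∀ {k} → ¬ p ∣ₙ k → one k ≡ + 0
      one-vanishes {zero}  p∤0 = ⊥-elim (p∤0 (dividesₙ 0 refl))
      one-vanishes {suc _} _   = refl

    W≈one+V : ∀ k → W p p k ≈ one k + V p p k
    W≈one+V k = begin
        W p p k
      ≡⟨ W≡ΣCV p p k ⟩
        + 1 * one k + Σ< p G
      ≡⟨ cong₂ _+_ (ℤₚ.*-identityˡ (one k)) (Σ-last q G) ⟩
        one k + (Σ< q G + G q)
      ≈⟨ +-cong (≈-refl {one k})
                (+-cong (Σ-≈-prefix {f = G} z≤n (λ i _ → middle i)) (≈-refl {G q})) ⟩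
        one k + (+ 0 + + (p C p) * V p p k)
      ≡⟨ cong (λ c → one k + (+ 0 + + c * V p p k)) (nCn≡1 p) ⟩
        one k + (+ 0 + + 1 * V p p k)
      ≡⟨ cong (_+_ (one k)) (trans (ℤₚ.+-identityˡ _) (ℤₚ.*-identityˡ (V p p k))) ⟩
        one k + V p p k
      ∎
      where
      open ≈-Reasoning
      G : ℕ → ℤ
      G j = + (p C suc j) * V p (suc j) k
      middle : ∀ i → i < q → G i ≈ + 0
      middle i i<q = ≈-trans (*-cong (pCk≈0 p-prime (suc i) (s≤s z≤n) (s≤s i<q))
                                     (≈-refl {V p (suc i) k}))
                             (≈-reflexive (ℤₚ.*-zeroˡ (V p (suc i) k)))

    W≈monomial : ∀ k → W p p k ≈ monomial (p ℕ.* q) k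
    W≈monomial k = begin
      W p p k                                    ≈⟨ W≈one+V k ⟩
      one k + V p p k                            ≈⟨ +-cong (≈-refl {one k}) (V≈monomial k) ⟩
      one k + (monomial (p ℕ.* q) k - one k)     ≡⟨ cancel (one k) (monomial (p ℕ.* q) k) ⟩
      monomial (p ℕ.* q) k                       ∎
      where
      open ≈-Reasoning
      cancel : ∀ x y → x + (y - x) ≡ y
      cancel = solve-∀

open import Data.Nat using (_*_)
open import Data.Integer.Divisibility using (_∣_)

mainTheorem8 : (p : ℕ) → Prime p →
    (k : ℕ) → (+ p) ∣ (W p p k - monomial (p * (p ∸ 1)) k)
mainTheorem8 zero    p-prime   = ⊥-elim (ℕ.≢-nonZero⁻¹ 0 {{prime⇒nonZero p-prime}} refl)
mainTheorem8 (suc q) p-prime k = ∣⇒∣ᵤ (Modular._≈_.divides-difference (W≈monomial p-prime k))
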